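{- Let $w$ be a finite Dean word that has exactly one right-special factor of length $2$. Then $|w|\le 23$.
   Context: Words are over the alphabet $\Sigma_4=\{0,1,2,3\}$. A word is reduced if it has no factor in $\{02,20,13,31\}$. A Dean word is a reduced square-free word (no factor $uu$ with $u$ nonempty). A factor $v$ of $w$ is right-special in $w$ if there are two distinct letters $a,b$ such that $va$ and $vb$ are both factors of $w$. -}

module Defs where

open import Data.Fin using (Fin; zero; suc)
open import Data.List using (List; []; _∷_; _++_; [_]; length)
open import Data.Nat using (ℕ; _≤_)
open import Data.Product using (Σ; ∃; _×_; _,_)
open import Relation.Binary.PropositionalEquality using (_≡_; _≢_)
open import Data.Sum using (_⊎_)
open import Relation.Nullary using (¬_)

Letter : Set
Letter = Fin 4

l0 l1 l2 l3 : Letter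
l0 = zero
l1 = suc zero
l2 = suc (suc zero)
l3 = suc (suc (suc zero))

Word : Set
Word = List Letter

Factor : Word → Word → Set
Factor f w = ∃ λ u → ∃ λ v → w ≡ u ++ f ++ v

Forbidden : Word → Set
Forbidden f = (f ≡ l0 ∷ l2 ∷ []) ⊎ (f ≡ l2 ∷ l0 ∷ []) ⊎ (f ≡ l1 ∷ l3 ∷ []) ⊎ (f ≡ l3 ∷ l1 ∷ [])

Reduced : Word → Set
Reduced w = ∀ f → Factor f w → ¬ Forbidden f

SquareFree : Word → Set
SquareFree w = ∀ u → u ≢ [] → ¬ Factor (u ++ u) w

Dean : Word → Set
Dean w = Reduced w × SquareFree w

RightSpecial : Word → Word → Set
RightSpecial v w =
  Factor v w × (Σ Letter λ a → Σ Letter λ b → a ≢ b × Factor (v ++ [ a ]) w × Factor (v ++ [ b ]) w)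

ExactlyOneRS2 : Word → Set
ExactlyOneRS2 w = Σ Word λ v → (length v ≡ 2 × RightSpecial v w)
  × (∀ v' → length v' ≡ 2 → RightSpecial v' w → v' ≡ v)

-- A square, a forbidden factor, or two distinct right-special factors of length 2 in a
-- word persist in every extension of it. So it suffices that every word of length 24
-- has a prefix with such a defect: this is a finite search over the tree of words,
-- pruned at defective prefixes (about 13000 nodes), which Agda runs while type checking.
module Submission where

open import Defs
open import Data.Bool using (Bool; T; _∨_)
open import Data.Bool.ListAction using (all)
open import Data.Bool.Properties using (T-∨)
open import Data.Empty using (⊥; ⊥-elim)
open import Data.Fin.Properties using (_≟_)
open import Data.List using (List; []; _∷_; _++_; [_]; length; take; drop; tails; allFin)
open import Data.List.Membership.Propositional using (_∈_; find)
open import Data.List.Membership.Propositional.Properties using (∈-allFin)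
open import Data.List.Properties using (≡-dec; ++-assoc; ++-identityʳ; take++drop≡id)
open import Data.List.Relation.Unary.All as All using ()
open import Data.List.Relation.Unary.All.Properties using (all⁺)
open import Data.List.Relation.Unary.Any using (Any; here; there; any?)
open import Data.Nat using (ℕ; zero; suc; _≤_; s≤s; ⌊_/2⌋; _≤?_)
open import Data.Nat.Properties using (≰⇒>; ≤-pred)
open import Data.Product using (_×_; _,_)
open import Data.Sum using (_⊎_; inj₁; inj₂)
open import Function using (Equivalence)
open import Relation.Binary.Definitions using (DecidableEquality)
open import Relation.Binary.PropositionalEquality
  using (_≡_; _≢_; refl; sym; trans; cong; subst; module ≡-Reasoning)
open import Relation.Nullary using (Dec; yes; no; ¬_; ¬?; _×-dec_; _⊎-dec_; True; isYes; toWitness)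
open import Relation.Unary using (Decidable)

infix 4 _≟ʷ_
_≟ʷ_ : DecidableEquality Word
_≟ʷ_ = ≡-dec _≟_

Admissible : Word → Set
Admissible w = Dean w × ExactlyOneRS2 w

RightSpecial₂ : Word → Word → Set
RightSpecial₂ v w = length v ≡ 2 × RightSpecial v w

factor-++ʳ : ∀ {f w} s → Factor f w → Factor f (w ++ s)
factor-++ʳ {f} s (u , v , refl) = u , v ++ s , (begin
  (u ++ f ++ v) ++ s   ≡⟨ ++-assoc u (f ++ v) s ⟩
  u ++ (f ++ v) ++ s   ≡⟨ cong (u ++_) (++-assoc f v s) ⟩
  u ++ f ++ v ++ s     ∎)
  where open ≡-Reasoning

factor-take : ∀ {r w} n → Factor r w → Factor (take n r) w
factor-take {r} n (u , v , refl) = u , drop n r ++ v , cong (u ++_) (begin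
  r ++ v                        ≡⟨ cong (_++ v) (take++drop≡id n r) ⟨
  (take n r ++ drop n r) ++ v   ≡⟨ ++-assoc (take n r) (drop n r) v ⟩
  take n r ++ drop n r ++ v     ∎)
  where open ≡-Reasoning

∈-tails⇒factor : ∀ {r : Word} w → r ∈ tails w → Factor r w
∈-tails⇒factor []      (here refl)  = [] , [] , refl
∈-tails⇒factor (x ∷ w) (here refl)  = [] , [] , sym (++-identityʳ (x ∷ w))
∈-tails⇒factor (x ∷ w) (there r∈ts) =
  let u , v , w≡urv = ∈-tails⇒factor w r∈ts in x ∷ u , v , cong (x ∷_) w≡urv

rightSpecial-++ʳ : ∀ {v w} s → RightSpecial v w → RightSpecial v (w ++ s)
rightSpecial-++ʳ s (v∈w , a , b , a≢b , va∈w , vb∈w) =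
  factor-++ʳ s v∈w , a , b , a≢b , factor-++ʳ s va∈w , factor-++ʳ s vb∈w

data Defect (w : Word) : Set where
  square           : ∀ u → u ≢ [] → Factor (u ++ u) w → Defect w
  forbidden        : ∀ f → Forbidden f → Factor f w → Defect w
  twoRightSpecials : ∀ v v′ → v ≢ v′ → RightSpecial₂ v w → RightSpecial₂ v′ w → Defect w

defect-++ʳ : ∀ {w} s → Defect w → Defect (w ++ s)
defect-++ʳ s (square u u≢[] uu∈w)  = square u u≢[] (factor-++ʳ s uu∈w)
defect-++ʳ s (forbidden f bad f∈w) = forbidden f bad (factor-++ʳ s f∈w)
defect-++ʳ s (twoRightSpecials v v′ v≢v′ (∣v∣ , rs) (∣v′∣ , rs′)) =
  twoRightSpecials v v′ v≢v′ (∣v∣ , rightSpecial-++ʳ s rs) (∣v′∣ , rightSpecial-++ʳ s rs′)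

defect⇒¬admissible : ∀ {w} → Defect w → ¬ Admissible w
defect⇒¬admissible (square u u≢[] uu∈w)  ((_ , squareFree) , _) = squareFree u u≢[] uu∈w
defect⇒¬admissible (forbidden f bad f∈w) ((reduced , _) , _)    = reduced f f∈w bad
defect⇒¬admissible (twoRightSpecials v v′ v≢v′ (∣v∣ , rs) (∣v′∣ , rs′)) (_ , _ , _ , unique) =
  v≢v′ (trans (unique v ∣v∣ rs) (sym (unique v′ ∣v′∣ rs′)))

half : Word → Word
half r = take ⌊ length r /2⌋ r

-- Only squares that are suffixes are detected; this suffices because the search
-- below tests every prefix, and every square is a suffix of some prefix.
SquareByHalves : Word → Set
SquareByHalves r = half r ≢ [] × r ≡ half r ++ half r

squareByHalves? : Decidable SquareByHalves
squareByHalves? r = ¬? (half r ≟ʷ []) ×-dec r ≟ʷ half r ++ half r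

forbidden? : Decidable Forbidden
forbidden? f =
  f ≟ʷ l0 ∷ l2 ∷ [] ⊎-dec f ≟ʷ l2 ∷ l0 ∷ [] ⊎-dec f ≟ʷ l1 ∷ l3 ∷ [] ⊎-dec f ≟ʷ l3 ∷ l1 ∷ []

ForbiddenStart : Word → Set
ForbiddenStart r = Forbidden (take 2 r)

forbiddenStart? : Decidable ForbiddenStart
forbiddenStart? r = forbidden? (take 2 r)

Forks : Word → Word → Set
Forks (x ∷ y ∷ a ∷ _) (x′ ∷ y′ ∷ b ∷ _) = x ≡ x′ × y ≡ y′ × a ≢ b
Forks _ _ = ⊥

forks? : ∀ r r′ → Dec (Forks r r′)
forks? (x ∷ y ∷ a ∷ _) (x′ ∷ y′ ∷ b ∷ _) = x ≟ x′ ×-dec y ≟ y′ ×-dec ¬? (a ≟ b)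
forks? []              _            = no λ ()
forks? (_ ∷ [])        _            = no λ ()
forks? (_ ∷ _ ∷ [])    _            = no λ ()
forks? (_ ∷ _ ∷ _ ∷ _) []           = no λ ()
forks? (_ ∷ _ ∷ _ ∷ _) (_ ∷ [])     = no λ ()
forks? (_ ∷ _ ∷ _ ∷ _) (_ ∷ _ ∷ []) = no λ ()

ForksIn : List Word → Word → Set
ForksIn rs r = Any (Forks r) rs

forksIn? : ∀ rs → Decidable (ForksIn rs)
forksIn? rs r = any? (forks? r) rs

TwoForks : List Word → Set
TwoForks rs = Any (λ r → ForksIn rs r × Any (λ r′ → take 2 r ≢ take 2 r′ × ForksIn rs r′) rs) rs

twoForks? : Decidable TwoForks
twoForks? rs =
  any? (λ r → forksIn? rs r ×-dec any? (λ r′ → ¬? (take 2 r ≟ʷ take 2 r′) ×-dec forksIn? rs r′) rs) rs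

forks⇒rightSpecial₂ : ∀ w {r r′} → r ∈ tails w → r′ ∈ tails w → Forks r r′ → RightSpecial₂ (take 2 r) w
forks⇒rightSpecial₂ w {_ ∷ _ ∷ a ∷ _} {_ ∷ _ ∷ b ∷ _} r∈ts r′∈ts (refl , refl , a≢b) =
  refl , factor-take 2 r∈w , a , b , a≢b , factor-take 3 r∈w , factor-take 3 (∈-tails⇒factor w r′∈ts)
  where r∈w = ∈-tails⇒factor w r∈ts

forksIn⇒rightSpecial₂ : ∀ w {r} → r ∈ tails w → ForksIn (tails w) r → RightSpecial₂ (take 2 r) w
forksIn⇒rightSpecial₂ w r∈ts fork =
  let _ , r′∈ts , r⋔r′ = find fork in forks⇒rightSpecial₂ w r∈ts r′∈ts r⋔r′

Obstruction : Word → Set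
Obstruction w = Any SquareByHalves (tails w) ⊎ Any ForbiddenStart (tails w) ⊎ TwoForks (tails w)

obstruction? : Decidable Obstruction
obstruction? w =
  any? squareByHalves? (tails w) ⊎-dec any? forbiddenStart? (tails w) ⊎-dec twoForks? (tails w)

obstruction⇒defect : ∀ {w} → Obstruction w → Defect w
obstruction⇒defect {w} (inj₁ sq) with find sq
... | r , r∈ts , h≢[] , r≡hh = square (half r) h≢[] (subst (λ f → Factor f w) r≡hh (∈-tails⇒factor w r∈ts))
obstruction⇒defect {w} (inj₂ (inj₁ fb)) with find fb
... | r , r∈ts , bad = forbidden (take 2 r) bad (factor-take 2 (∈-tails⇒factor w r∈ts))
obstruction⇒defect {w} (inj₂ (inj₂ two)) with find two
... | r , r∈ts , fork , others with find others
... | r′ , r′∈ts , r≢r′ , fork′ =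
  twoRightSpecials _ _ r≢r′ (forksIn⇒rightSpecial₂ w r∈ts fork) (forksIn⇒rightSpecial₂ w r′∈ts fork′)

NoAdmissibleExtension : ℕ → Word → Set
NoAdmissibleExtension k p = ∀ s → k ≤ length s → ¬ Admissible (p ++ s)

defect⇒noAdmissibleExtension : ∀ {p} k → Defect p → NoAdmissibleExtension k p
defect⇒noAdmissibleExtension k defect s _ = defect⇒¬admissible (defect-++ʳ s defect)

noAdmissibleExtension-step : ∀ k p → (∀ a → NoAdmissibleExtension k (p ++ [ a ])) →
                             NoAdmissibleExtension (suc k) p
noAdmissibleExtension-step k p none (a ∷ s) (s≤s k≤∣s∣) =
  subst (λ w → ¬ Admissible w) (++-assoc p [ a ] s) (none a s k≤∣s∣)

search : ℕ → Word → Bool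
search zero    p = isYes (obstruction? p)
search (suc k) p = isYes (obstruction? p) ∨ all (λ a → search k (p ++ [ a ])) (allFin 4)

obstruction⇒noAdmissibleExtension : ∀ k p → True (obstruction? p) → NoAdmissibleExtension k p
obstruction⇒noAdmissibleExtension k p found =
  defect⇒noAdmissibleExtension k (obstruction⇒defect (toWitness found))

search-sound : ∀ k p → T (search k p) → NoAdmissibleExtension k p
search-sound zero    p found = obstruction⇒noAdmissibleExtension zero p found
search-sound (suc k) p found with Equivalence.to T-∨ found
... | inj₁ obstructed = obstruction⇒noAdmissibleExtension (suc k) p obstructed
... | inj₂ allFound   = noAdmissibleExtension-step k p λ a →
  search-sound k (p ++ [ a ]) (All.lookup everyExtensionFound (∈-allFin a))
  where everyExtensionFound = all⁺ (λ b → search k (p ++ [ b ])) (allFin 4) allFound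

noAdmissibleWord-length≥24 : NoAdmissibleExtension 24 []
noAdmissibleWord-length≥24 = search-sound 24 [] _

mainTheorem10 : ∀ w → Dean w → ExactlyOneRS2 w → length w ≤ 23
mainTheorem10 w dean one with 24 ≤? length w
... | yes long  = ⊥-elim (noAdmissibleWord-length≥24 w long (dean , one))
... | no  short = ≤-pred (≰⇒> short)
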